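{- $\mathsf{CR}$ is conservative over $\mathsf{PA}$: every $\mathcal L$-formula provable in $\mathsf{CR}$ is provable in $\mathsf{PA}$.
   Context: $\mathcal L$: language of $\mathsf{PA}$ with $\to,\forall,=$, constant $0$ and function symbols for all primitive recursive functions; fixed Gödel numbering. Pairing $\langle\cdot,\cdot\rangle$ with projections $(\cdot)_0,(\cdot)_1$; $x\cdot y\simeq z$ is the $\Sigma^0_1$ formula saying the $x$-th partial recursive function on input $y$ halts with output $z$; $\mathrm{Eq}(y,z)$ ($\Sigma^0_1$) says $y,z$ code closed terms of equal value; $\mathrm{Sent}_{\mathcal L}(x)$: $x$ codes an $\mathcal L$-sentence; $\forall\ulcorner s\urcorner$ ranges over codes of closed terms; $\forall\ulcorner A_x\urcorner\in\mathrm{Sent}_{\mathcal L}$ over codes of formulas with at most $x$ free; $\ulcorner A(\dot x)\urcorner$ is the code of $A(\bar n)$, $n$ the value of $x$. $\mathsf{CR}$: in $\mathcal L_{\mathrm R}=\mathcal L\cup\{\in\perp\!\!\!\perp,F,T\}$ ($x\in\perp\!\!\!\perp$ unary, $x\,F\,y$, $x\,T\,y$ binary), $\mathsf{PA}$ with full induction plus universal closures of: $x\cdot y\simeq z\to(z\in\perp\!\!\!\perp\to\langle x,y\rangle\in\perp\!\!\!\perp)$; $\forall\ulcorner A\urcorner\in\mathrm{Sent}_{\mathcal L}.\ a\,T\,\ulcorner A\urcorner\leftrightarrow\forall b(b\,F\,\ulcorner A\urcorner\to\langle a,b\rangle\in\perp\!\!\!\perp)$; $\forall\ulcorner s\urcorner,\ulcorner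 t\urcorner.\ a\,F\,\ulcorner s=t\urcorner\leftrightarrow(\mathrm{Eq}(\ulcorner s\urcorner,\ulcorner t\urcorner)\to a\in\perp\!\!\!\perp)$; $\forall\ulcorner A\urcorner,\ulcorner B\urcorner\in\mathrm{Sent}_{\mathcal L}.\ a\,F\,\ulcorner A\to B\urcorner\leftrightarrow((a)_0\,T\,\ulcorner A\urcorner\wedge(a)_1\,F\,\ulcorner B\urcorner)$; $\forall\ulcorner A_x\urcorner\in\mathrm{Sent}_{\mathcal L}.\ a\,F\,\ulcorner\forall xA\urcorner\leftrightarrow(a)_1\,F\,\ulcorner A((\dot a)_0)\urcorner$. -}

module Defs where

open import Data.Nat using (ℕ; zero; suc; _+_; _<_; _≟_)
open import Data.Fin using (Fin; fromℕ<)
open import Data.Vec using (Vec; []; _∷_; lookup)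
open import Data.List using (List; []; _∷_)
open import Data.Maybe using (Maybe; just; nothing)
open import Data.Product using (Σ; _×_; _,_; ∃; proj₁; proj₂)
open import Data.Empty using (⊥)
open import Relation.Binary.PropositionalEquality using (_≡_)
open import Relation.Nullary using (yes; no)
open import Data.Nat using (_<?_)
open import Function.Bundles using (_⇔_)

-- Primitive recursive function descriptions (the function symbols of L)

data PR : ℕ → Set where
  Z    : ∀ {n} → PR n
  S    : PR 1
  P    : ∀ {n} → Fin n → PR n
  Comp : ∀ {n m} → PR m → Vec (PR n) m → PR n
  Rec  : ∀ {n} → PR n → PR (suc (suc n)) → PR (suc n)

mutual
  evalPR : ∀ {n} → PR n → Vec ℕ n → ℕ
  evalPR Z xs = 0
  evalPR S (x ∷ []) = suc x
  evalPR (P i) xs = lookup xs i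
  evalPR (Comp f gs) xs = evalPR f (evalPRs gs xs)
  evalPR (Rec g h) (x ∷ xs) = recPR g h x xs

  evalPRs : ∀ {n m} → Vec (PR n) m → Vec ℕ n → Vec ℕ m
  evalPRs [] xs = []
  evalPRs (g ∷ gs) xs = evalPR g xs ∷ evalPRs gs xs

  recPR : ∀ {n} → PR n → PR (suc (suc n)) → ℕ → Vec ℕ n → ℕ
  recPR g h zero xs = evalPR g xs
  recPR g h (suc x) xs = evalPR h (x ∷ recPR g h x xs ∷ xs)

data Term : Set where
  var  : ℕ → Term
  zero' : Term
  fn   : ∀ {n} → PR n → Vec Term n → Term

-- L = arithmetic language; LR = L ∪ {∈⊥⊥, F, T}
data Lang : Set where
  L LR : Lang

infixr 5 _⇒_
infix 7 _≐_

data Fm : Lang → Set where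
  _≐_  : ∀ {ℓ} → Term → Term → Fm ℓ
  _⇒_  : ∀ {ℓ} → Fm ℓ → Fm ℓ → Fm ℓ
  ∀'   : ∀ {ℓ} → Fm ℓ → Fm ℓ              -- binds de Bruijn variable 0
  perp : Term → Fm LR
  Frel : Term → Term → Fm LR
  Trel : Term → Term → Fm LR

embed : Fm L → Fm LR
embed (s ≐ t) = s ≐ t
embed (A ⇒ B) = embed A ⇒ embed B
embed (∀' A) = ∀' (embed A)

suc' : Term → Term
suc' t = fn S (t ∷ [])

⊥' : ∀ {ℓ} → Fm ℓ
⊥' = zero' ≐ suc' zero'

¬' : ∀ {ℓ} → Fm ℓ → Fm ℓ
¬' A = A ⇒ ⊥'

_∧'_ : ∀ {ℓ} → Fm ℓ → Fm ℓ → Fm ℓ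
A ∧' B = ¬' (A ⇒ ¬' B)

_⇔'_ : ∀ {ℓ} → Fm ℓ → Fm ℓ → Fm ℓ
A ⇔' B = (A ⇒ B) ∧' (B ⇒ A)

∃' : ∀ {ℓ} → Fm ℓ → Fm ℓ
∃' A = ¬' (∀' (¬' A))

numeral : ℕ → Term
numeral zero = zero'
numeral (suc n) = suc' (numeral n)

mutual
  renT : (ℕ → ℕ) → Term → Term
  renT ρ (var i) = var (ρ i)
  renT ρ zero' = zero'
  renT ρ (fn f ts) = fn f (renTs ρ ts)

  renTs : ∀ {n} → (ℕ → ℕ) → Vec Term n → Vec Term n
  renTs ρ [] = []
  renTs ρ (t ∷ ts) = renT ρ t ∷ renTs ρ ts

mutual
  subT : (ℕ → Term) → Term → Term
  subT σ (var i) = σ i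
  subT σ zero' = zero'
  subT σ (fn f ts) = fn f (subTs σ ts)

  subTs : ∀ {n} → (ℕ → Term) → Vec Term n → Vec Term n
  subTs σ [] = []
  subTs σ (t ∷ ts) = subT σ t ∷ subTs σ ts

liftS : (ℕ → Term) → ℕ → Term
liftS σ zero = var zero
liftS σ (suc i) = renT suc (σ i)

subF : ∀ {ℓ} → (ℕ → Term) → Fm ℓ → Fm ℓ
subF σ (s ≐ t) = subT σ s ≐ subT σ t
subF σ (A ⇒ B) = subF σ A ⇒ subF σ B
subF σ (∀' A) = ∀' (subF (liftS σ) A)
subF σ (perp t) = perp (subT σ t)
subF σ (Frel s t) = Frel (subT σ s) (subT σ t)
subF σ (Trel s t) = Trel (subT σ s) (subT σ t)

-- substitute the list of terms for variables 0,1,...; other variables shift down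
listSub : List Term → ℕ → Term
listSub [] i = var i
listSub (t ∷ ts) zero = t
listSub (t ∷ ts) (suc i) = listSub ts i

_[_] : ∀ {ℓ} → Fm ℓ → Term → Fm ℓ
A [ t ] = subF (listSub (t ∷ [])) A

shiftF : ∀ {ℓ} → Fm ℓ → Fm ℓ
shiftF A = subF (λ i → var (suc i)) A

sucSub : ℕ → Term
sucSub zero = suc' (var zero)
sucSub (suc i) = var (suc i)

-- Hilbert-style classical first-order logic with equality + PA axioms
-- (PA: successor axioms, defining equations of every primitive recursive
-- function symbol, induction for all formulas of the language ℓ),
-- relative to a set Ax of extra axioms.

mapPR : ∀ {n m} → Vec (PR n) m → Vec Term n → Vec Term m
mapPR [] ts = []
mapPR (g ∷ gs) ts = fn g ts ∷ mapPR gs ts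

data _⊢_ {ℓ : Lang} (Ax : Fm ℓ → Set) : Fm ℓ → Set where
  ax     : ∀ {A} → Ax A → Ax ⊢ A
  mp     : ∀ {A B} → Ax ⊢ (A ⇒ B) → Ax ⊢ A → Ax ⊢ B
  gen    : ∀ {A} → Ax ⊢ A → Ax ⊢ ∀' A
  axK    : ∀ A B → Ax ⊢ (A ⇒ B ⇒ A)
  axS    : ∀ A B C → Ax ⊢ ((A ⇒ B ⇒ C) ⇒ (A ⇒ B) ⇒ A ⇒ C)
  axDNE  : ∀ A → Ax ⊢ (¬' (¬' A) ⇒ A)
  axInst : ∀ A t → Ax ⊢ (∀' A ⇒ A [ t ])
  axDist : ∀ A B → Ax ⊢ (∀' (shiftF A ⇒ B) ⇒ A ⇒ ∀' B)
  axRefl : ∀ t → Ax ⊢ (t ≐ t)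
  axLeib : ∀ A s t → Ax ⊢ (s ≐ t ⇒ A [ s ] ⇒ A [ t ])
  axS0   : ∀ t → Ax ⊢ ¬' (suc' t ≐ zero')
  axSinj : ∀ s t → Ax ⊢ (suc' s ≐ suc' t ⇒ s ≐ t)
  axZ    : ∀ {n} (ts : Vec Term n) → Ax ⊢ (fn Z ts ≐ zero')
  axP    : ∀ {n} (i : Fin n) (ts : Vec Term n) → Ax ⊢ (fn (P i) ts ≐ lookup ts i)
  axComp : ∀ {n m} (f : PR m) (gs : Vec (PR n) m) (ts : Vec Term n) →
           Ax ⊢ (fn (Comp f gs) ts ≐ fn f (mapPR gs ts))
  axRec0 : ∀ {n} (g : PR n) (h : PR (suc (suc n))) (ts : Vec Term n) →
           Ax ⊢ (fn (Rec g h) (zero' ∷ ts) ≐ fn g ts)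
  axRecS : ∀ {n} (g : PR n) (h : PR (suc (suc n))) (t : Term) (ts : Vec Term n) →
           Ax ⊢ (fn (Rec g h) (suc' t ∷ ts) ≐ fn h (t ∷ fn (Rec g h) (t ∷ ts) ∷ ts))
  axInd  : ∀ A → Ax ⊢ (A [ zero' ] ⇒ ∀' (A ⇒ subF sucSub A) ⇒ ∀' A)

noAx : ∀ {ℓ} → Fm ℓ → Set
noAx _ = ⊥

PA⊢ : Fm L → Set
PA⊢ A = noAx ⊢ A

mutual
  evalT : (ℕ → ℕ) → Term → ℕ
  evalT ρ (var i) = ρ i
  evalT ρ zero' = 0
  evalT ρ (fn f ts) = evalPR f (evalTs ρ ts)

  evalTs : ∀ {n} → (ℕ → ℕ) → Vec Term n → Vec ℕ n
  evalTs ρ [] = []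
  evalTs ρ (t ∷ ts) = evalT ρ t ∷ evalTs ρ ts

cons : ℕ → (ℕ → ℕ) → ℕ → ℕ
cons n ρ zero = n
cons n ρ (suc i) = ρ i

env : List ℕ → ℕ → ℕ
env [] i = 0
env (n ∷ ns) zero = n
env (n ∷ ns) (suc i) = env ns i

Sat : (ℕ → ℕ) → Fm L → Set
Sat ρ (s ≐ t) = evalT ρ s ≡ evalT ρ t
Sat ρ (A ⇒ B) = Sat ρ A → Sat ρ B
Sat ρ (∀' A) = (n : ℕ) → Sat (cons n ρ) A

mutual
  TermBelow : ℕ → Term → Set
  TermBelow k (var i) = i < k
  TermBelow k zero' = ⊤'
  TermBelow k (fn f ts) = TermsBelow k ts

  TermsBelow : ∀ {n} → ℕ → Vec Term n → Set
  TermsBelow k [] = ⊤'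
  TermsBelow k (t ∷ ts) = TermBelow k t × TermsBelow k ts

  data ⊤' : Set where
    tt' : ⊤'

FmBelow : ∀ {ℓ} → ℕ → Fm ℓ → Set
FmBelow k (s ≐ t) = TermBelow k s × TermBelow k t
FmBelow k (A ⇒ B) = FmBelow k A × FmBelow k B
FmBelow k (∀' A) = FmBelow (suc k) A
FmBelow k (perp t) = TermBelow k t
FmBelow k (Frel s t) = TermBelow k s × TermBelow k t
FmBelow k (Trel s t) = TermBelow k s × TermBelow k t

tri : ℕ → ℕ
tri zero = zero
tri (suc n) = suc n + tri n

⟪_,_⟫ : ℕ → ℕ → ℕ
⟪ x , y ⟫ = tri (x + y) + y

unpair : ℕ → ℕ × ℕ
unpair zero = 0 , 0
unpair (suc z) with unpair z
... | zero , y = suc y , 0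
... | suc x , y = x , suc y

mutual
  codePR : ∀ {n} → PR n → ℕ
  codePR {n} Z = ⟪ 0 , n ⟫
  codePR S = ⟪ 1 , 0 ⟫
  codePR {n} (P i) = ⟪ 2 , ⟪ n , Data.Fin.toℕ i ⟫ ⟫
  codePR {n} (Comp {m = m} f gs) = ⟪ 3 , ⟪ n , ⟪ m , ⟪ codePR f , codePRs gs ⟫ ⟫ ⟫ ⟫
  codePR {suc n} (Rec g h) = ⟪ 4 , ⟪ n , ⟪ codePR g , codePR h ⟫ ⟫ ⟫

  codePRs : ∀ {n m} → Vec (PR n) m → ℕ
  codePRs [] = 0
  codePRs (g ∷ gs) = suc ⟪ codePR g , codePRs gs ⟫

mutual
  ⌜_⌝T : Term → ℕ
  ⌜ var i ⌝T = ⟪ 0 , i ⟫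
  ⌜ zero' ⌝T = ⟪ 1 , 0 ⟫
  ⌜ fn f ts ⌝T = ⟪ 2 , ⟪ codePR f , codeTs ts ⟫ ⟫

  codeTs : ∀ {n} → Vec Term n → ℕ
  codeTs [] = 0
  codeTs (t ∷ ts) = suc ⟪ ⌜ t ⌝T , codeTs ts ⟫

⌜_⌝ : Fm L → ℕ
⌜ s ≐ t ⌝ = ⟪ 0 , ⟪ ⌜ s ⌝T , ⌜ t ⌝T ⟫ ⟫
⌜ A ⇒ B ⌝ = ⟪ 1 , ⟪ ⌜ A ⌝ , ⌜ B ⌝ ⟫ ⟫
⌜ ∀' A ⌝ = ⟪ 2 , ⌜ A ⌝ ⟫

-- A fixed enumeration of the partial recursive functions
-- (μ-recursive descriptions, decoded from ℕ, evaluated with fuel)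

data MR : ℕ → Set where
  Zm    : ∀ {n} → MR n
  Sm    : MR 1
  Pm    : ∀ {n} → Fin n → MR n
  Compm : ∀ {n m} → MR m → Vec (MR n) m → MR n
  Recm  : ∀ {n} → MR n → MR (suc (suc n)) → MR (suc n)
  Mum   : ∀ {n} → MR (suc n) → MR n     -- least y with f(y,xs) = 0

private
  bindM : {A B : Set} → Maybe A → (A → Maybe B) → Maybe B
  bindM nothing k = nothing
  bindM (just a) k = k a

mutual
  decMR : ℕ → (n : ℕ) → ℕ → Maybe (MR n)
  decMR zero n c = nothing
  decMR (suc fuel) n c = decTag fuel n (proj₁ (unpair c)) (proj₂ (unpair c))

  decTag : ℕ → (n : ℕ) → ℕ → ℕ → Maybe (MR n)
  decTag fuel n 0 d = just Zm
  decTag fuel (suc zero) 1 d = just Sm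
  decTag fuel n 2 d with d <? n
  ... | yes p = just (Pm (fromℕ< p))
  ... | no _ = nothing
  decTag fuel n 3 d =
    bindM (decMR fuel (proj₁ (unpair d)) (proj₁ (unpair (proj₂ (unpair d))))) λ f →
    bindM (decMRs fuel n (proj₁ (unpair d)) (proj₂ (unpair (proj₂ (unpair d))))) λ gs →
    just (Compm f gs)
  decTag fuel (suc n) 4 d =
    bindM (decMR fuel n (proj₁ (unpair d))) λ g →
    bindM (decMR fuel (suc (suc n)) (proj₂ (unpair d))) λ h →
    just (Recm g h)
  decTag fuel n 5 d =
    bindM (decMR fuel (suc n) d) λ f → just (Mum f)
  decTag fuel n _ d = nothing

  decMRs : ℕ → (n m : ℕ) → ℕ → Maybe (Vec (MR n) m)
  decMRs fuel n zero c = just []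
  decMRs zero n (suc m) c = nothing
  decMRs (suc fuel) n (suc m) c =
    bindM (decMR fuel n (proj₁ (unpair c))) λ g →
    bindM (decMRs fuel n m (proj₂ (unpair c))) λ gs →
    just (g ∷ gs)

mutual
  evalMR : ℕ → ∀ {n} → MR n → Vec ℕ n → Maybe ℕ
  evalMR zero f xs = nothing
  evalMR (suc k) Zm xs = just 0
  evalMR (suc k) Sm (x ∷ []) = just (suc x)
  evalMR (suc k) (Pm i) xs = just (lookup xs i)
  evalMR (suc k) (Compm f gs) xs =
    bindM (evalMRs k gs xs) λ ys → evalMR k f ys
  evalMR (suc k) (Recm g h) (x ∷ xs) = recMR k g h x xs
  evalMR (suc k) (Mum f) xs = muMR k k f 0 xs

  evalMRs : ℕ → ∀ {n m} → Vec (MR n) m → Vec ℕ n → Maybe (Vec ℕ m)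
  evalMRs k [] xs = just []
  evalMRs k (g ∷ gs) xs =
    bindM (evalMR k g xs) λ y → bindM (evalMRs k gs xs) λ ys → just (y ∷ ys)

  recMR : ℕ → ∀ {n} → MR n → MR (suc (suc n)) → ℕ → Vec ℕ n → Maybe ℕ
  recMR k g h zero xs = evalMR k g xs
  recMR k g h (suc x) xs = bindM (recMR k g h x xs) λ r → evalMR k h (x ∷ r ∷ xs)

  muMR : ℕ → ℕ → ∀ {n} → MR (suc n) → ℕ → Vec ℕ n → Maybe ℕ
  muMR k zero f y xs = nothing
  muMR k (suc bound) f y xs =
    bindM (evalMR k f (y ∷ xs)) λ { zero → just y ; (suc _) → muMR k bound f (suc y) xs }

-- x · y ≃ z : the x-th partial recursive function halts on y with output z
KleeneApp : ℕ → ℕ → ℕ → Set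
KleeneApp x y z =
  Σ (MR 1) λ f → decMR (suc x) 1 x ≡ just f × Σ ℕ λ k → evalMR k f (y ∷ []) ≡ just z

-- The arithmetised notions used in the axioms of CR, as L-formulas /
-- primitive recursive function symbols, together with the requirement that
-- they express what the paper says they express.

record Arith : Set where
  field
    pair  : PR 2
    pr0   : PR 1
    pr1   : PR 1
    impC  : PR 2
    eqC   : PR 2
    allC  : PR 1
    subC  : PR 2
    sentF : Fm L
    fml1F : Fm L
    ctF   : Fm L
    eqF   : Fm L
    appF  : Fm L

    pair-0 : ∀ x y → evalPR pr0 (evalPR pair (x ∷ y ∷ []) ∷ []) ≡ x
    pair-1 : ∀ x y → evalPR pr1 (evalPR pair (x ∷ y ∷ []) ∷ []) ≡ y
    impC-ok : ∀ A B → evalPR impC (⌜ A ⌝ ∷ ⌜ B ⌝ ∷ []) ≡ ⌜ A ⇒ B ⌝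
    eqC-ok  : ∀ s t → evalPR eqC (⌜ s ⌝T ∷ ⌜ t ⌝T ∷ []) ≡ ⌜ s ≐ t ⌝
    allC-ok : ∀ A → evalPR allC (⌜ A ⌝ ∷ []) ≡ ⌜ ∀' A ⌝
    subC-ok : ∀ A n → evalPR subC (⌜ A ⌝ ∷ n ∷ []) ≡ ⌜ A [ numeral n ] ⌝

    sentF-free : FmBelow 1 sentF
    sentF-ok : ∀ x → Sat (env (x ∷ [])) sentF ⇔ (Σ (Fm L) λ A → FmBelow 0 A × ⌜ A ⌝ ≡ x)
    fml1F-free : FmBelow 1 fml1F
    fml1F-ok : ∀ x → Sat (env (x ∷ [])) fml1F ⇔ (Σ (Fm L) λ A → FmBelow 1 A × ⌜ A ⌝ ≡ x)
    ctF-free : FmBelow 1 ctF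
    ctF-ok : ∀ x → Sat (env (x ∷ [])) ctF ⇔ (Σ Term λ t → TermBelow 0 t × ⌜ t ⌝T ≡ x)

    eqF-Σ1 : Σ (PR 3) λ g →
      eqF ≡ ∃' (fn g (var 0 ∷ var 1 ∷ var 2 ∷ []) ≐ zero')
    eqF-ok : ∀ y z → Sat (env (y ∷ z ∷ [])) eqF ⇔
      (Σ Term λ s → Σ Term λ t → TermBelow 0 s × TermBelow 0 t ×
         ⌜ s ⌝T ≡ y × ⌜ t ⌝T ≡ z × evalT (env []) s ≡ evalT (env []) t)
    appF-Σ1 : Σ (PR 4) λ g →
      appF ≡ ∃' (fn g (var 0 ∷ var 1 ∷ var 2 ∷ var 3 ∷ []) ≐ zero')
    appF-ok : ∀ x y z → Sat (env (x ∷ y ∷ z ∷ [])) appF ⇔ KleeneApp x y z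

module CR (ar : Arith) where
  open Arith ar

  at : Fm L → List Term → Fm LR
  at A ts = subF (listSub ts) (embed A)

  ⟨_,_⟩ : Term → Term → Term
  ⟨ s , t ⟩ = fn pair (s ∷ t ∷ [])

  π₀ π₁ : Term → Term
  π₀ t = fn pr0 (t ∷ [])
  π₁ t = fn pr1 (t ∷ [])

  v : ℕ → Term
  v = var

  -- ∀x∀y∀z. x·y≃z → (z ∈⊥⊥ → ⟨x,y⟩ ∈⊥⊥)        (x = v2, y = v1, z = v0)
  ax-app : Fm LR
  ax-app = ∀' (∀' (∀' (at appF (v 2 ∷ v 1 ∷ v 0 ∷ []) ⇒
             (perp (v 0) ⇒ perp ⟨ v 2 , v 1 ⟩))))

  -- ∀a∀x. Sent(x) → (a T x ↔ ∀b (b F x → ⟨a,b⟩ ∈⊥⊥))   (a = v1, x = v0)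
  ax-T : Fm LR
  ax-T = ∀' (∀' (at sentF (v 0 ∷ []) ⇒
           (Trel (v 1) (v 0) ⇔' ∀' (Frel (v 0) (v 1) ⇒ perp ⟨ v 2 , v 0 ⟩))))

  -- ∀a∀s∀t. CT(s) → CT(t) → (a F ⌜s=t⌝ ↔ (Eq(s,t) → a ∈⊥⊥))  (a = v2, s = v1, t = v0)
  ax-F= : Fm LR
  ax-F= = ∀' (∀' (∀' (at ctF (v 1 ∷ []) ⇒ at ctF (v 0 ∷ []) ⇒
            (Frel (v 2) (fn eqC (v 1 ∷ v 0 ∷ [])) ⇔'
              (at eqF (v 1 ∷ v 0 ∷ []) ⇒ perp (v 2))))))

  -- ∀a∀x∀y. Sent(x) → Sent(y) → (a F ⌜x→y⌝ ↔ ((a)₀ T x ∧ (a)₁ F y))  (a = v2, x = v1, y = v0)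
  ax-F⇒ : Fm LR
  ax-F⇒ = ∀' (∀' (∀' (at sentF (v 1 ∷ []) ⇒ at sentF (v 0 ∷ []) ⇒
            (Frel (v 2) (fn impC (v 1 ∷ v 0 ∷ [])) ⇔'
              (Trel (π₀ (v 2)) (v 1) ∧' Frel (π₁ (v 2)) (v 0))))))

  -- ∀a∀x. Fml₁(x) → (a F ⌜∀x A⌝ ↔ (a)₁ F ⌜A((a)₀)⌝)   (a = v1, x = v0)
  ax-F∀ : Fm LR
  ax-F∀ = ∀' (∀' (at fml1F (v 0 ∷ []) ⇒
            (Frel (v 1) (fn allC (v 0 ∷ [])) ⇔'
              Frel (π₁ (v 1)) (fn subC (v 0 ∷ π₀ (v 1) ∷ [])))))

  data CRAx : Fm LR → Set where
    a-app : CRAx ax-app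
    a-T   : CRAx ax-T
    a-F=  : CRAx ax-F=
    a-F⇒  : CRAx ax-F⇒
    a-F∀  : CRAx ax-F∀

CR⊢ : Arith → Fm LR → Set
CR⊢ ar A = CR.CRAx ar ⊢ A

{-# OPTIONS --safe #-}
module Submission where

-- Interpret the new predicates x ∈⊥⊥, x F y and x T y all by the true formula
-- 0 = 0. This commutes with substitution, so logical axioms and PA axioms
-- (induction for L_R-formulas included) become instances of the same schemata
-- over L, and every axiom of CR becomes a tautology built from 0 = 0: each of
-- its biconditionals has both sides true. The image of a CR-proof of an
-- L-formula is thus a PA-proof of that same formula.

open import Defs
open import Data.Nat using (ℕ; suc)
open import Data.List using (_∷_; [])
open import Relation.Binary.PropositionalEquality using (_≡_; refl; cong; cong₂; subst)

verum : ∀ {ℓ} → Fm ℓ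
verum = zero' ≐ zero'

trivialise : ∀ {ℓ} → Fm ℓ → Fm L
trivialise (s ≐ t) = s ≐ t
trivialise (A ⇒ B) = trivialise A ⇒ trivialise B
trivialise (∀' A) = ∀' (trivialise A)
trivialise (perp t) = verum
trivialise (Frel s t) = verum
trivialise (Trel s t) = verum

trivialise-subF : ∀ {ℓ} (σ : ℕ → Term) (A : Fm ℓ) →
                  trivialise (subF σ A) ≡ subF σ (trivialise A)
trivialise-subF σ (s ≐ t) = refl
trivialise-subF σ (A ⇒ B) = cong₂ _⇒_ (trivialise-subF σ A) (trivialise-subF σ B)
trivialise-subF σ (∀' A) = cong ∀' (trivialise-subF (liftS σ) A)
trivialise-subF σ (perp t) = refl
trivialise-subF σ (Frel s t) = refl
trivialise-subF σ (Trel s t) = refl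

trivialise-embed : (A : Fm L) → trivialise (embed A) ≡ A
trivialise-embed (s ≐ t) = refl
trivialise-embed (A ⇒ B) = cong₂ _⇒_ (trivialise-embed A) (trivialise-embed B)
trivialise-embed (∀' A) = cong ∀' (trivialise-embed A)

module _ {ℓ} {Ax : Fm ℓ → Set} where

  ⊢verum : Ax ⊢ verum
  ⊢verum = axRefl zero'

  ⊢-const : ∀ {A} B → Ax ⊢ A → Ax ⊢ (B ⇒ A)
  ⊢-const {A} B ⊢A = mp (axK A B) ⊢A

  ⊢-id : ∀ A → Ax ⊢ (A ⇒ A)
  ⊢-id A = mp (mp (axS A (A ⇒ A) A) (axK A (A ⇒ A))) (axK A A)

  ⊢-∧-intro : ∀ {A B} → Ax ⊢ A → Ax ⊢ B → Ax ⊢ (A ∧' B)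
  ⊢-∧-intro {A} {B} ⊢A ⊢B = mp (mp (axS C B ⊥') C⇒¬B) (⊢-const C ⊢B)
    where
    C : Fm ℓ
    C = A ⇒ ¬' B

    C⇒¬B : Ax ⊢ (C ⇒ ¬' B)
    C⇒¬B = mp (mp (axS C A (¬' B)) (⊢-id C)) (⊢-const C ⊢A)

  ⊢-⇔-intro : ∀ {A B} → Ax ⊢ A → Ax ⊢ B → Ax ⊢ (A ⇔' B)
  ⊢-⇔-intro {A} {B} ⊢A ⊢B = ⊢-∧-intro (⊢-const A ⊢B) (⊢-const B ⊢A)

trivialise-⊢ : ∀ {ℓ} {Ax : Fm ℓ → Set} {Ax′ : Fm L → Set} →
               (∀ {A} → Ax A → Ax′ ⊢ trivialise A) →
               ∀ {A} → Ax ⊢ A → Ax′ ⊢ trivialise A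
trivialise-⊢ ⊢ax (ax a) = ⊢ax a
trivialise-⊢ ⊢ax (mp p q) = mp (trivialise-⊢ ⊢ax p) (trivialise-⊢ ⊢ax q)
trivialise-⊢ ⊢ax (gen p) = gen (trivialise-⊢ ⊢ax p)
trivialise-⊢ ⊢ax (axK A B) = axK (trivialise A) (trivialise B)
trivialise-⊢ ⊢ax (axS A B C) = axS (trivialise A) (trivialise B) (trivialise C)
trivialise-⊢ ⊢ax (axDNE A) = axDNE (trivialise A)
trivialise-⊢ ⊢ax (axInst A t)
  rewrite trivialise-subF (listSub (t ∷ [])) A = axInst (trivialise A) t
trivialise-⊢ ⊢ax (axDist A B)
  rewrite trivialise-subF (λ i → var (suc i)) A = axDist (trivialise A) (trivialise B)
trivialise-⊢ ⊢ax (axRefl t) = axRefl t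
trivialise-⊢ ⊢ax (axLeib A s t)
  rewrite trivialise-subF (listSub (s ∷ [])) A
        | trivialise-subF (listSub (t ∷ [])) A = axLeib (trivialise A) s t
trivialise-⊢ ⊢ax (axS0 t) = axS0 t
trivialise-⊢ ⊢ax (axSinj s t) = axSinj s t
trivialise-⊢ ⊢ax (axZ ts) = axZ ts
trivialise-⊢ ⊢ax (axP i ts) = axP i ts
trivialise-⊢ ⊢ax (axComp f gs ts) = axComp f gs ts
trivialise-⊢ ⊢ax (axRec0 g h ts) = axRec0 g h ts
trivialise-⊢ ⊢ax (axRecS g h t ts) = axRecS g h t ts
trivialise-⊢ ⊢ax (axInd A)
  rewrite trivialise-subF (listSub (zero' ∷ [])) A
        | trivialise-subF sucSub A = axInd (trivialise A)

trivialise-CRAx : (ar : Arith) → ∀ {A} → CR.CRAx ar A → PA⊢ (trivialise A)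
trivialise-CRAx ar CR.a-app = gen (gen (gen (⊢-const _ (⊢-const _ ⊢verum))))
trivialise-CRAx ar CR.a-T =
  gen (gen (⊢-const _ (⊢-⇔-intro ⊢verum (gen (⊢-const _ ⊢verum)))))
trivialise-CRAx ar CR.a-F= =
  gen (gen (gen (⊢-const _ (⊢-const _ (⊢-⇔-intro ⊢verum (⊢-const _ ⊢verum))))))
trivialise-CRAx ar CR.a-F⇒ =
  gen (gen (gen (⊢-const _ (⊢-const _ (⊢-⇔-intro ⊢verum (⊢-∧-intro ⊢verum ⊢verum))))))
trivialise-CRAx ar CR.a-F∀ = gen (gen (⊢-const _ (⊢-⇔-intro ⊢verum ⊢verum)))

proposition3 : (ar : Arith) (A : Fm L) → CR⊢ ar (embed A) → PA⊢ A
proposition3 ar A ⊢A =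
  subst PA⊢ (trivialise-embed A) (trivialise-⊢ (trivialise-CRAx ar) ⊢A)
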